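{- Let $k\geq2$ be an integer. For every $j \in \{1,\ldots,k-1\}$, $C_{2^j-1}\not\equiv C_{2^k-1} \pmod{2^{k+1}}$.
   Context: $C_n := \frac{(2n)!}{(n+1)!\,n!}$ denotes the $n$-th Catalan number. -}

module Defs where

open import Data.Nat.Base using (ℕ; suc; _*_; _/_; _!)
open import Data.Nat.Properties using (_!*_!≢0)

catalan : ℕ → ℕ
catalan n = ((2 * n) !) / ((suc n) ! * n !)
  where instance _ = (suc n) !* n !≢0

-- Write b = 2^m − 1. Since (2n)! = 2^n n! (2n−1)!!, the Catalan numbers satisfy
-- C_{2b+1} (2b−1)!! = C_b ∏_{i<b} (2^{m+1} + 2i + 1). Modulo 2^{m+2} that product is
-- (2b−1)!! + 2^{m+1} b, and b, (2b−1)!! and (by induction) C_b are odd, so cancelling the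
-- odd factor (2b−1)!! gives C_{2^{m+1}−1} ≡ C_{2^m−1} + 2^{m+1} (mod 2^{m+2}) for m ≥ 1.
-- Chaining these congruences, C_{2^k−1} ≡ C_{2^j−1} + 2^{j+1} (mod 2^{j+2}) whenever
-- 1 ≤ j < k, while 2^{j+2} divides 2^{k+1}.
module Submission where

open import Data.Nat.Base using (ℕ; zero; suc; _+_; _*_; _∸_; _^_; _%_; _/_; _!; _≤_; _<_; z≤n; s≤s; NonZero)
open import Data.Nat.Properties using (m^n≢0; +-identityʳ; +-suc; +-comm; *-identityʳ; *-assoc; *-cancelʳ-≡; *-commutativeSemigroup; ^-distribˡ-+-*; ^-monoʳ-<; m+n∸n≡m; m∸n+n≡m; m≤m+n; m≤n+m; ≤-trans; m≤n⇒m<n∨m≡n; <⇒≱; n<1+n; suc-pred; _!≢0; _!*_!≢0)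
open import Data.Nat.Combinatorics using (k![n∸k]!∣n!)
open import Data.Nat.Coprimality using (Coprime; coprime-divisor; coprime-+; 1-coprimeTo) renaming (sym to coprime-sym)
open import Data.Nat.Divisibility using (_∣_; divides; divides-refl; ∣-refl; ∣-trans; ∣1⇒≡1; ∣⇒≤; *-cancelˡ-∣)
open import Data.Nat.DivMod using (m/n*n≡m; m≡m%n+[m/n]*n)
open import Data.Nat.Tactic.RingSolver using (solve-∀)
open import Data.Integer.Base as ℤ using (ℤ; +_)
open import Data.Integer.Properties using (pos-*; +-minus-telescope) renaming (*-comm to ℤ*-comm)
import Data.Integer.Divisibility.Signed as Signed
import Data.Integer.Coprimality as ℤ
import Data.Integer.Tactic.RingSolver as ℤ-Solver
open import Algebra.Properties.CommutativeSemigroup *-commutativeSemigroup using (xy∙z≈xz∙y)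
open import Data.Product using (_,_; ∃-syntax)
open import Data.Sum using (inj₁; inj₂)
open import Relation.Binary.PropositionalEquality using (_≡_; _≢_; refl; sym; trans; cong; cong₂; subst; module ≡-Reasoning)
open import Defs

-- oddProduct p n = (p + 1)(p + 3) ⋯ (p + 2n − 1); in particular oddProduct 0 n = (2n − 1)!!.
oddProduct : ℕ → ℕ → ℕ
oddProduct p zero    = 1
oddProduct p (suc n) = oddProduct p n * (p + suc (2 * n))

oddProduct-+ : ∀ p m n → oddProduct p (m + n) ≡ oddProduct p m * oddProduct (p + 2 * m) n
oddProduct-+ p m zero = begin
  oddProduct p (m + 0)  ≡⟨ cong (oddProduct p) (+-identityʳ m) ⟩
  oddProduct p m        ≡⟨ *-identityʳ (oddProduct p m) ⟨
  oddProduct p m * 1    ∎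
  where open ≡-Reasoning
oddProduct-+ p m (suc n) = begin
  oddProduct p (m + suc n)                                              ≡⟨ cong (oddProduct p) (+-suc m n) ⟩
  oddProduct p (m + n) * (p + suc (2 * (m + n)))                        ≡⟨ cong₂ _*_ (oddProduct-+ p m n) (factor p m n) ⟩
  oddProduct p m * oddProduct (p + 2 * m) n * (p + 2 * m + suc (2 * n)) ≡⟨ *-assoc (oddProduct p m) _ _ ⟩
  oddProduct p m * oddProduct (p + 2 * m) (suc n)                       ∎
  where
  open ≡-Reasoning
  factor : ∀ p m n → p + suc (2 * (m + n)) ≡ p + 2 * m + suc (2 * n)
  factor = solve-∀

oddProduct-odd : ∀ c n → ∃[ w ] oddProduct (2 * c) n ≡ 1 + w * 2
oddProduct-odd c zero    = 0 , refl
oddProduct-odd c (suc n) with oddProduct-odd c n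
... | w , eq = c + n + w * (2 * c + suc (2 * n)) , trans (cong (_* (2 * c + suc (2 * n))) eq) (expand c n w)
  where
  expand : ∀ c n w → (1 + w * 2) * (2 * c + suc (2 * n)) ≡ 1 + (c + n + w * (2 * c + suc (2 * n))) * 2
  expand = solve-∀

oddProduct-shift : ∀ c n → ∃[ t ] oddProduct (2 * c) n ≡ oddProduct 0 n + 2 * c * n + t * (2 * (2 * c))
oddProduct-shift c zero = 0 , base c
  where
  base : ∀ c → 1 ≡ 1 + 2 * c * 0 + 0 * (2 * (2 * c))
  base = solve-∀
oddProduct-shift c (suc n) with oddProduct-shift c n | oddProduct-odd 0 n
... | t , eq | w , O-odd = t′ , (begin
  oddProduct (2 * c) n * (2 * c + o)                        ≡⟨ cong (_* (2 * c + o)) eq ⟩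
  (O + 2 * c * n + t * (2 * (2 * c))) * (2 * c + o)         ≡⟨ cong (λ x → (x + 2 * c * n + t * (2 * (2 * c))) * (2 * c + o)) O-odd ⟩
  (1 + w * 2 + 2 * c * n + t * (2 * (2 * c))) * (2 * c + o) ≡⟨ expand c n t w ⟩
  (1 + w * 2) * o + 2 * c * suc n + t′ * (2 * (2 * c))      ≡⟨ cong (λ x → x * o + 2 * c * suc n + t′ * (2 * (2 * c))) O-odd ⟨
  O * o + 2 * c * suc n + t′ * (2 * (2 * c))                ∎)
  where
  open ≡-Reasoning
  O = oddProduct 0 n
  o = suc (2 * n)
  t′ = w + c * n + 2 * c * t + n * n + t * o
  expand : ∀ c n t w → (1 + w * 2 + 2 * c * n + t * (2 * (2 * c))) * (2 * c + suc (2 * n))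
    ≡ (1 + w * 2) * suc (2 * n) + 2 * c * suc n + (w + c * n + 2 * c * t + n * n + t * suc (2 * n)) * (2 * (2 * c))
  expand = solve-∀

[2n]!≡2^n*n!*oddProduct : ∀ n → (2 * n) ! ≡ 2 ^ n * n ! * oddProduct 0 n
[2n]!≡2^n*n!*oddProduct zero    = refl
[2n]!≡2^n*n!*oddProduct (suc n) = begin
  (2 * suc n) !                                                ≡⟨ cong _! (2[1+n]≡2+2n n) ⟩
  (2 + 2 * n) * ((1 + 2 * n) * (2 * n) !)                      ≡⟨ cong (λ x → (2 + 2 * n) * ((1 + 2 * n) * x))
                                                                       ([2n]!≡2^n*n!*oddProduct n) ⟩
  (2 + 2 * n) * ((1 + 2 * n) * (2 ^ n * n ! * oddProduct 0 n)) ≡⟨ regroup n (2 ^ n) (n !) (oddProduct 0 n) ⟩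
  2 ^ suc n * suc n ! * oddProduct 0 (suc n)                   ∎
  where
  open ≡-Reasoning
  2[1+n]≡2+2n : ∀ n → 2 * suc n ≡ 2 + 2 * n
  2[1+n]≡2+2n = solve-∀
  regroup : ∀ n a b c → (2 + 2 * n) * ((1 + 2 * n) * (a * b * c)) ≡ 2 * a * (b + n * b) * (c * (1 + 2 * n))
  regroup = solve-∀

coprime-∣-* : ∀ {a m n x} .{{_ : NonZero a}} → Coprime m n → a * m ∣ x → a * n ∣ x → a * m * n ∣ x
coprime-∣-* {a} {m} {n} m⊥n am∣x (divides-refl q) = divides r (begin
  q * (a * n)       ≡⟨ cong (_* (a * n)) q≡r*m ⟩
  r * m * (a * n)   ≡⟨ regroup r m a n ⟩
  r * (a * m * n)   ∎)
  where
  open ≡-Reasoning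
  regroup : ∀ r m a n → r * m * (a * n) ≡ r * (a * m * n)
  regroup = solve-∀
  m∣q : m ∣ q
  m∣q = coprime-divisor m⊥n (*-cancelˡ-∣ a (subst (a * m ∣_) (swap q a n) am∣x))
    where
    swap : ∀ q a n → q * (a * n) ≡ a * (n * q)
    swap = solve-∀
  r = _∣_.quotient m∣q
  q≡r*m = _∣_.equality m∣q

-- n! n! and (n + 1)! (n − 1)! divide (2n)!, and they are n! (n − 1)! times the coprime n and n + 1.
[1+n]!*n!∣[2n]! : ∀ n → suc n ! * n ! ∣ (2 * n) !
[1+n]!*n!∣[2n]! zero    = ∣-refl
[1+n]!*n!∣[2n]! (suc m) =
  subst (_∣ (2 * n) !) (regroup (n !) (m !) m) (coprime-∣-* {{n !* m !≢0}} n⊥1+n n!n!∣ [1+n]!m!∣)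
  where
  n = suc m
  regroup : ∀ a b m → a * b * suc m * suc (suc m) ≡ suc (suc m) * a * (suc m * b)
  regroup = solve-∀
  2n∸n≡n : 2 * n ∸ n ≡ n
  2n∸n≡n = subst (λ x → x ∸ n ≡ n) (split n) (m+n∸n≡m n n)
    where
    split : ∀ n → n + n ≡ 2 * n
    split = solve-∀
  2n∸[1+n]≡m : 2 * n ∸ suc n ≡ m
  2n∸[1+n]≡m = subst (λ x → x ∸ suc n ≡ m) (split m) (m+n∸n≡m m (suc n))
    where
    split : ∀ m → m + suc (suc m) ≡ 2 * suc m
    split = solve-∀
  n!n!∣ : n ! * m ! * n ∣ (2 * n) !
  n!n!∣ = subst (_∣ (2 * n) !) (swap (n !) (m !) m)
            (subst (λ x → n ! * x ! ∣ (2 * n) !) 2n∸n≡n (k![n∸k]!∣n! (m≤m+n n (n + 0))))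
    where
    swap : ∀ a b m → a * (suc m * b) ≡ a * b * suc m
    swap = solve-∀
  [1+n]!m!∣ : n ! * m ! * suc n ∣ (2 * n) !
  [1+n]!m!∣ = subst (_∣ (2 * n) !) (swap (n !) (m !) m)
                (subst (λ x → suc n ! * x ! ∣ (2 * n) !) 2n∸[1+n]≡m (k![n∸k]!∣n! 1+n≤2n))
    where
    swap : ∀ a b m → suc (suc m) * a * b ≡ a * b * suc (suc m)
    swap = solve-∀
    1+n≤2n : suc n ≤ 2 * n
    1+n≤2n = subst (suc n ≤_) (split m) (s≤s (m≤n+m n m))
      where
      split : ∀ m → suc (m + suc m) ≡ 2 * suc m
      split = solve-∀
  n⊥1+n : Coprime n (suc n)
  n⊥1+n = coprime-sym (subst (λ x → Coprime x n) (+-comm n 1) (coprime-+ (1-coprimeTo n)))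

catalan*[1+n]!*n! : ∀ n → catalan n * (suc n ! * n !) ≡ (2 * n) !
catalan*[1+n]!*n! n = m/n*n≡m {{suc n !* n !≢0}} ([1+n]!*n!∣[2n]! n)

catalan*[1+n]! : ∀ n → catalan n * suc n ! ≡ 2 ^ n * oddProduct 0 n
catalan*[1+n]! n = *-cancelʳ-≡ _ _ (n !) {{n !≢0}} (begin
  catalan n * suc n ! * n !       ≡⟨ *-assoc (catalan n) _ _ ⟩
  catalan n * (suc n ! * n !)     ≡⟨ catalan*[1+n]!*n! n ⟩
  (2 * n) !                       ≡⟨ [2n]!≡2^n*n!*oddProduct n ⟩
  2 ^ n * n ! * oddProduct 0 n    ≡⟨ xy∙z≈xz∙y (2 ^ n) (n !) (oddProduct 0 n) ⟩
  2 ^ n * oddProduct 0 n * n !    ∎)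
  where open ≡-Reasoning

catalan[1+2n]*[1+n]! : ∀ n → catalan (suc (2 * n)) * suc n ! ≡ 2 ^ n * oddProduct (2 * suc n) n
catalan[1+2n]*[1+n]! n = *-cancelʳ-≡ _ _ ((2 * suc n) !) {{(2 * suc n) !≢0}} (begin
  C * suc n ! * (2 * suc n) !                                ≡⟨ cong (λ x → C * suc n ! * x !) (2[1+n]≡2+2n n) ⟩
  C * suc n ! * (2 + 2 * n) !                                ≡⟨ regroup₁ C (suc n !) _ ⟩
  suc n ! * (C * (2 + 2 * n) !)                              ≡⟨ cong (suc n ! *_) (catalan*[1+n]! (suc (2 * n))) ⟩
  suc n ! * (2 ^ suc (2 * n) * oddProduct 0 (suc (2 * n)))   ≡⟨ cong (λ x → suc n ! * (2 ^ x * oddProduct 0 x)) (1+2n≡[1+n]+n n) ⟩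
  suc n ! * (2 ^ (suc n + n) * oddProduct 0 (suc n + n))     ≡⟨ cong (suc n ! *_) (cong₂ _*_ (^-distribˡ-+-* 2 (suc n) n) (oddProduct-+ 0 (suc n) n)) ⟩
  suc n ! * (2 ^ suc n * 2 ^ n * (oddProduct 0 (suc n) * G)) ≡⟨ regroup₂ (suc n !) (2 ^ suc n) (2 ^ n) (oddProduct 0 (suc n)) G ⟩
  2 ^ n * G * (2 ^ suc n * suc n ! * oddProduct 0 (suc n))   ≡⟨ cong (2 ^ n * G *_) ([2n]!≡2^n*n!*oddProduct (suc n)) ⟨
  2 ^ n * G * (2 * suc n) !                                  ∎)
  where
  open ≡-Reasoning
  C = catalan (suc (2 * n))
  G = oddProduct (2 * suc n) n
  2[1+n]≡2+2n : ∀ n → 2 * suc n ≡ 2 + 2 * n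
  2[1+n]≡2+2n = solve-∀
  1+2n≡[1+n]+n : ∀ n → suc (2 * n) ≡ suc n + n
  1+2n≡[1+n]+n = solve-∀
  regroup₁ : ∀ c f k → c * f * k ≡ f * (c * k)
  regroup₁ = solve-∀
  regroup₂ : ∀ f a b o g → f * (a * b * (o * g)) ≡ b * g * (a * f * o)
  regroup₂ = solve-∀

catalan[1+2n]*oddProduct : ∀ n → catalan (suc (2 * n)) * oddProduct 0 n ≡ catalan n * oddProduct (2 * suc n) n
catalan[1+2n]*oddProduct n = *-cancelʳ-≡ _ _ (suc n !) {{suc n !≢0}} (begin
  catalan (suc (2 * n)) * O * suc n !      ≡⟨ xy∙z≈xz∙y (catalan (suc (2 * n))) O (suc n !) ⟩
  catalan (suc (2 * n)) * suc n ! * O      ≡⟨ cong (_* O) (catalan[1+2n]*[1+n]! n) ⟩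
  2 ^ n * G * O                            ≡⟨ xy∙z≈xz∙y (2 ^ n) G O ⟩
  2 ^ n * O * G                            ≡⟨ cong (_* G) (catalan*[1+n]! n) ⟨
  catalan n * suc n ! * G                  ≡⟨ xy∙z≈xz∙y (catalan n) (suc n !) G ⟩
  catalan n * G * suc n !                  ∎)
  where
  open ≡-Reasoning
  O = oddProduct 0 n
  G = oddProduct (2 * suc n) n

coprime-* : ∀ {m n o} → Coprime m o → Coprime n o → Coprime (m * n) o
coprime-* {m} m⊥o n⊥o {i} (i∣mn , i∣o) = n⊥o (coprime-divisor i⊥m i∣mn , i∣o)
  where
  i⊥m : Coprime i m
  i⊥m (j∣i , j∣m) = m⊥o (j∣m , ∣-trans j∣i i∣o)

coprime-^ : ∀ {m n} k → Coprime m n → Coprime (m ^ k) n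
coprime-^ zero    _   = 1-coprimeTo _
coprime-^ (suc k) m⊥n = coprime-* m⊥n (coprime-^ k m⊥n)

^-monoʳ-∣ : ∀ m {n o} → n ≤ o → m ^ n ∣ m ^ o
^-monoʳ-∣ m {n} {o} n≤o =
  divides (m ^ (o ∸ n)) (trans (cong (m ^_) (sym (m∸n+n≡m n≤o))) (^-distribˡ-+-* m (o ∸ n) n))

-- A record rather than a synonym for the divisibility, so that x and y stay inferable.
infix 4 _≡_mod_
record _≡_mod_ (x y : ℤ) (n : ℕ) : Set where
  constructor ∣⇒≡-mod
  field
    ≡-mod⇒∣ : + n Signed.∣ x ℤ.- y
open _≡_mod_

≡-mod-sym : ∀ {x y n} → x ≡ y mod n → y ≡ x mod n
≡-mod-sym {x} {y} (∣⇒≡-mod n∣x-y) = ∣⇒≡-mod (subst (_ Signed.∣_) (negate x y) (Signed.∣m⇒∣-m n∣x-y))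
  where
  negate : ∀ x y → ℤ.- (x ℤ.- y) ≡ y ℤ.- x
  negate = ℤ-Solver.solve-∀

≡-mod-trans : ∀ {x y z n} → x ≡ y mod n → y ≡ z mod n → x ≡ z mod n
≡-mod-trans {x} {y} {z} (∣⇒≡-mod n∣x-y) (∣⇒≡-mod n∣y-z) =
  ∣⇒≡-mod (subst (_ Signed.∣_) (+-minus-telescope x y z) (Signed.∣m∣n⇒∣m+n n∣x-y n∣y-z))

≡-mod-weaken : ∀ {x y m n} → m ∣ n → x ≡ y mod n → x ≡ y mod m
≡-mod-weaken m∣n (∣⇒≡-mod n∣x-y) = ∣⇒≡-mod (Signed.∣-trans (Signed.∣ᵤ⇒∣ m∣n) n∣x-y)

≡-mod-+-multiple : ∀ {x y z n} → x ≡ y ℤ.+ z mod n → + n Signed.∣ z → x ≡ y mod n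
≡-mod-+-multiple {x} {y} {z} (∣⇒≡-mod n∣x-[y+z]) n∣z =
  ∣⇒≡-mod (subst (_ Signed.∣_) (regroup x y z) (Signed.∣m∣n⇒∣m+n n∣x-[y+z] n∣z))
  where
  regroup : ∀ x y z → x ℤ.- (y ℤ.+ z) ℤ.+ z ≡ x ℤ.- y
  regroup = ℤ-Solver.solve-∀

+-≡-mod⇒∣ : ∀ {x z n} → x ℤ.+ z ≡ x mod n → + n Signed.∣ z
+-≡-mod⇒∣ {x} {z} (∣⇒≡-mod n∣x+z-x) = subst (_ Signed.∣_) (cancel x z) n∣x+z-x
  where
  cancel : ∀ x z → x ℤ.+ z ℤ.- x ≡ z
  cancel = ℤ-Solver.solve-∀

≡+q*n⇒≡-mod : ∀ {x y n} q → x ≡ y + q * n → + x ≡ + y mod n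
≡+q*n⇒≡-mod {y = y} {n} q refl = ∣⇒≡-mod (Signed.divides (+ q) (begin
  + y ℤ.+ + (q * n) ℤ.- + y  ≡⟨ cancel (+ y) (+ (q * n)) ⟩
  + (q * n)                  ≡⟨ pos-* q n ⟩
  + q ℤ.* + n                ∎))
  where
  open ≡-Reasoning
  cancel : ∀ x z → x ℤ.+ z ℤ.- x ≡ z
  cancel = ℤ-Solver.solve-∀

%≡%⇒≡-mod : ∀ {x y n} .{{_ : NonZero n}} → x % n ≡ y % n → + x ≡ + y mod n
%≡%⇒≡-mod {x} {y} {n} x%n≡y%n = ≡-mod-trans
  (≡+q*n⇒≡-mod (x / n) (m≡m%n+[m/n]*n x n))
  (≡-mod-sym (≡+q*n⇒≡-mod (y / n) (subst (λ r → y ≡ r + y / n * n) (sym x%n≡y%n) (m≡m%n+[m/n]*n y n))))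

odd⇒coprime-2^ : ∀ n {o} → o ≡ + 1 mod 2 → ℤ.Coprime (+ (2 ^ n)) o
odd⇒coprime-2^ n {o} (∣⇒≡-mod 2∣o-1) = coprime-^ n 2⊥o
  where
  o-[o-1]≡1 : o ℤ.- (o ℤ.- + 1) ≡ + 1
  o-[o-1]≡1 = cancel o
    where
    cancel : ∀ o → o ℤ.- (o ℤ.- + 1) ≡ + 1
    cancel = ℤ-Solver.solve-∀
  2⊥o : Coprime 2 ℤ.∣ o ∣
  2⊥o {i} (i∣2 , i∣o) = ∣1⇒≡1 (Signed.∣⇒∣ᵤ (subst (+ i Signed.∣_) o-[o-1]≡1
    (Signed.∣m∣n⇒∣m-n {+ i} {o} (Signed.∣ᵤ⇒∣ {+ i} i∣o) (Signed.∣-trans (Signed.∣ᵤ⇒∣ {+ i} i∣2) 2∣o-1))))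

a*o≡b*g⇒a≡b+2ⁿ : ∀ n {a b o g} → a ℤ.* o ≡ b ℤ.* g → o ≡ + 1 mod 2 → b ≡ + 1 mod 2 →
  g ≡ o ℤ.+ + (2 ^ n) mod 2 ^ suc n → a ≡ b ℤ.+ + (2 ^ n) mod 2 ^ suc n
a*o≡b*g⇒a≡b+2ⁿ n {a} {b} {o} {g} ao≡bg o-odd b-odd (∣⇒≡-mod 2ⁿ⁺¹∣g-[o+2ⁿ]) =
  ∣⇒≡-mod (Signed.∣ᵤ⇒∣ (ℤ.coprime-divisor (+ (2 ^ suc n)) o (a ℤ.- (b ℤ.+ M)) (odd⇒coprime-2^ (suc n) o-odd)
    (Signed.∣⇒∣ᵤ (subst (_ Signed.∣_) (sym expand) (Signed.∣m∣n⇒∣m+n (Signed.∣n⇒∣m*n b 2ⁿ⁺¹∣g-[o+2ⁿ]) 2ⁿ⁺¹∣2ⁿ[b-o])))))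
  where
  open ≡-Reasoning
  M = + (2 ^ n)
  expand : o ℤ.* (a ℤ.- (b ℤ.+ M)) ≡ b ℤ.* (g ℤ.- (o ℤ.+ M)) ℤ.+ M ℤ.* (b ℤ.- o)
  expand = begin
    o ℤ.* (a ℤ.- (b ℤ.+ M))                     ≡⟨ distrib a b o M ⟩
    a ℤ.* o ℤ.- b ℤ.* o ℤ.- M ℤ.* o             ≡⟨ cong (λ x → x ℤ.- b ℤ.* o ℤ.- M ℤ.* o) ao≡bg ⟩
    b ℤ.* g ℤ.- b ℤ.* o ℤ.- M ℤ.* o             ≡⟨ regroup b o g M ⟩
    b ℤ.* (g ℤ.- (o ℤ.+ M)) ℤ.+ M ℤ.* (b ℤ.- o) ∎
    where
    distrib : ∀ a b o M → o ℤ.* (a ℤ.- (b ℤ.+ M)) ≡ a ℤ.* o ℤ.- b ℤ.* o ℤ.- M ℤ.* o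
    distrib = ℤ-Solver.solve-∀
    regroup : ∀ b o g M → b ℤ.* g ℤ.- b ℤ.* o ℤ.- M ℤ.* o ≡ b ℤ.* (g ℤ.- (o ℤ.+ M)) ℤ.+ M ℤ.* (b ℤ.- o)
    regroup = ℤ-Solver.solve-∀
  2ⁿ⁺¹∣2ⁿ[b-o] : + (2 ^ suc n) Signed.∣ M ℤ.* (b ℤ.- o)
  2ⁿ⁺¹∣2ⁿ[b-o] = subst (Signed._∣ (M ℤ.* (b ℤ.- o))) (trans (ℤ*-comm M (+ 2)) (sym (pos-* 2 (2 ^ n))))
    (Signed.*-monoʳ-∣ M (≡-mod⇒∣ (≡-mod-trans b-odd (≡-mod-sym o-odd))))

oddProduct-≡-mod : ∀ c {b z} → b ≡ suc (2 * z) → + oddProduct (2 * c) b ≡ + oddProduct 0 b ℤ.+ + (2 * c) mod 2 * (2 * c)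
oddProduct-≡-mod c {z = z} refl with oddProduct-shift c (suc (2 * z))
... | t , eq = ≡+q*n⇒≡-mod (z + t) (trans eq (regroup (oddProduct 0 (suc (2 * z))) c z t))
  where
  regroup : ∀ O c z t → O + 2 * c * suc (2 * z) + t * (2 * (2 * c)) ≡ O + 2 * c + (z + t) * (2 * (2 * c))
  regroup = solve-∀

2^[1+m]∸1≡1+2[2^m∸1] : ∀ m → 2 ^ suc m ∸ 1 ≡ suc (2 * (2 ^ m ∸ 1))
2^[1+m]∸1≡1+2[2^m∸1] m =
  trans (cong (λ x → 2 * x ∸ 1) (sym (suc-pred (2 ^ m) {{m^n≢0 2 m}}))) (cong (_∸ 1) (double-suc (2 ^ m ∸ 1)))
  where
  double-suc : ∀ x → 2 * suc x ≡ 2 + 2 * x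
  double-suc = solve-∀

mersenneCatalan : ℕ → ℕ
mersenneCatalan m = catalan (2 ^ m ∸ 1)

mersenneCatalan-step : ∀ n → + mersenneCatalan (1 + n) ≡ + 1 mod 2 →
  + mersenneCatalan (2 + n) ≡ + mersenneCatalan (1 + n) ℤ.+ + (2 ^ (2 + n)) mod 2 ^ (3 + n)
mersenneCatalan-step n C-odd =
  a*o≡b*g⇒a≡b+2ⁿ (2 + n) C′O≡CG O-odd C-odd
    (oddProduct-≡-mod (2 ^ suc n) {z = 2 ^ n ∸ 1} (2^[1+m]∸1≡1+2[2^m∸1] n))
  where
  open ≡-Reasoning
  b = 2 ^ suc n ∸ 1
  O = oddProduct 0 b
  G = oddProduct (2 ^ (2 + n)) b
  C′O≡CG : + mersenneCatalan (2 + n) ℤ.* + O ≡ + mersenneCatalan (1 + n) ℤ.* + G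
  C′O≡CG = begin
    + mersenneCatalan (2 + n) ℤ.* + O       ≡⟨ pos-* (mersenneCatalan (2 + n)) O ⟨
    + (catalan (2 ^ (2 + n) ∸ 1) * O)       ≡⟨ cong (λ x → + (catalan x * O)) (2^[1+m]∸1≡1+2[2^m∸1] (suc n)) ⟩
    + (catalan (suc (2 * b)) * O)           ≡⟨ cong +_ (catalan[1+2n]*oddProduct b) ⟩
    + (catalan b * oddProduct (2 * suc b) b) ≡⟨ cong (λ x → + (catalan b * oddProduct (2 * x) b)) (suc-pred (2 ^ suc n) {{m^n≢0 2 (suc n)}}) ⟩
    + (catalan b * G)                       ≡⟨ pos-* (catalan b) G ⟩
    + mersenneCatalan (1 + n) ℤ.* + G       ∎
  O-odd : + O ≡ + 1 mod 2
  O-odd with oddProduct-odd 0 b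
  ... | w , eq = ≡+q*n⇒≡-mod w eq

mersenneCatalan-odd : ∀ n → + mersenneCatalan (1 + n) ≡ + 1 mod 2
mersenneCatalan-odd zero    = ∣⇒≡-mod (Signed.divides (+ 0) refl)
mersenneCatalan-odd (suc n) = ≡-mod-trans Cₙ₊₂≡Cₙ₊₁ (mersenneCatalan-odd n)
  where
  Cₙ₊₂≡Cₙ₊₁ : + mersenneCatalan (2 + n) ≡ + mersenneCatalan (1 + n) mod 2
  Cₙ₊₂≡Cₙ₊₁ = ≡-mod-+-multiple {z = + (2 ^ (2 + n))}
    (≡-mod-weaken (^-monoʳ-∣ 2 {1} {3 + n} (s≤s z≤n)) (mersenneCatalan-step n (mersenneCatalan-odd n)))
    (Signed.∣ᵤ⇒∣ (^-monoʳ-∣ 2 {1} {2 + n} (s≤s z≤n)))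

mersenneCatalan-suc : ∀ {m} → 1 ≤ m → + mersenneCatalan (suc m) ≡ + mersenneCatalan m ℤ.+ + (2 ^ suc m) mod 2 ^ (2 + m)
mersenneCatalan-suc {suc n} _ = mersenneCatalan-step n (mersenneCatalan-odd n)

mersenneCatalan-≡ : ∀ {j k} → 1 ≤ j → j < k → + mersenneCatalan k ≡ + mersenneCatalan j ℤ.+ + (2 ^ suc j) mod 2 ^ (2 + j)
mersenneCatalan-≡ {j} {suc k} 1≤j (s≤s j≤k) with m≤n⇒m<n∨m≡n j≤k
... | inj₂ refl = mersenneCatalan-suc 1≤j
... | inj₁ j<k  = ≡-mod-trans Cₖ₊₁≡Cₖ (mersenneCatalan-≡ 1≤j j<k)
  where
  Cₖ₊₁≡Cₖ : + mersenneCatalan (suc k) ≡ + mersenneCatalan k mod 2 ^ (2 + j)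
  Cₖ₊₁≡Cₖ = ≡-mod-+-multiple {z = + (2 ^ suc k)}
    (≡-mod-weaken (^-monoʳ-∣ 2 (s≤s (s≤s j≤k))) (mersenneCatalan-suc (≤-trans 1≤j j≤k)))
    (Signed.∣ᵤ⇒∣ (^-monoʳ-∣ 2 (s≤s j<k)))

proposition3p2 : (k : ℕ) → 2 ≤ k → (j : ℕ) → 1 ≤ j → j ≤ k ∸ 1 →
    _%_ (catalan (2 ^ j ∸ 1)) (2 ^ (k + 1)) {{m^n≢0 2 (k + 1)}} ≢ _%_ (catalan (2 ^ k ∸ 1)) (2 ^ (k + 1)) {{m^n≢0 2 (k + 1)}}
proposition3p2 zero    ()
proposition3p2 (suc k) _  j 1≤j j≤k Cⱼ%≡Cₖ% =
  <⇒≱ (^-monoʳ-< 2 (s≤s (s≤s z≤n)) (n<1+n (suc j))) (∣⇒≤ {{m^n≢0 2 (suc j)}} 2ʲ⁺²∣2ʲ⁺¹)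
  where
  Cⱼ≡Cₖ : + mersenneCatalan j ≡ + mersenneCatalan (suc k) mod 2 ^ (2 + j)
  Cⱼ≡Cₖ = ≡-mod-weaken (^-monoʳ-∣ 2 (subst (2 + j ≤_) (+-comm 1 (suc k)) (s≤s (s≤s j≤k))))
                       (%≡%⇒≡-mod {{m^n≢0 2 (suc k + 1)}} Cⱼ%≡Cₖ%)
  2ʲ⁺²∣2ʲ⁺¹ : 2 ^ (2 + j) ∣ 2 ^ (1 + j)
  2ʲ⁺²∣2ʲ⁺¹ = Signed.∣⇒∣ᵤ (+-≡-mod⇒∣ {z = + (2 ^ suc j)}
    (≡-mod-trans (≡-mod-sym (mersenneCatalan-≡ 1≤j (s≤s j≤k))) (≡-mod-sym Cⱼ≡Cₖ)))
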